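{- Let $U_1,U_2,V_1,V_2$ be $\lambda H$-terms and $k\ge0$. If $U_1\rightarrow_{(I^*,k)}V_1$, $U_2\rightarrow_{(J^*,k)}V_2$ and $E(U_1)=E(U_2)$, then $E(V_1)=E(V_2)$.
   Context: $\lambda H$-terms are the $\lambda$-terms built from variables and one additional constant $H$ by abstraction and application. Application is left-associative. The head reduction step $\rightarrow_t$ is $\lambda\overline{x}\,((\lambda x\,A)\,B)\,W_1\ldots W_n\rightarrow_t\lambda\overline{x}\,A[B/x]\,W_1\ldots W_n$. The $I$-reduction is $\lambda\overline{x}\,H\,U_1\ldots U_n\rightarrow_I\lambda\overline{x}\,U_1\ldots U_n$ ($n\ge1$). The $J$-reduction is $\lambda\overline{x}\,H\,U_1U_2U_3\ldots U_n\rightarrow_J\lambda\overline{x}\,U_1\,(H\,U_2)\,U_3\ldots U_n$ for $n\ge2$, and $\lambda\overline{x}\,H\,U_1\rightarrow_J\lambda\overline{x}\,U_1$. $U\rightarrow_{(I^*,k)}V$ (resp. $U\rightarrow_{(J^*,k)}V$) means $V$ is obtained from $U$ by a finite sequence of steps consisting of $I$-reductions (resp. $J$-reductions) and exactly $k$ $t$-reductions. The map $E$ is defined by: $E(x)=x$; $E(H)=H$; $E(\lambda x\,U)=\lambda x\,E(U)$; $E(U\,V)=E(U)\,E(V)$ if $U$ is not of the form $H\,U_1\ldots U_n$ with $n\ge0$; and $E(H\,U_1\ldots U_n)=E(U_1\ldots U_n)$ for $n\ge1$. -}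

module Defs where

open import Data.Nat using (ℕ; zero; suc; _+_)
open import Data.List using (List; []; _∷_; _∷ʳ_)
open import Data.Maybe using (Maybe; just; nothing)
import Data.Maybe as Maybe

-- λH-terms, with de Bruijn indices (so syntactic equality = α-equivalence)

data Term : Set where
  var : ℕ → Term
  H   : Term
  lam : Term → Term
  app : Term → Term → Term

apps : Term → List Term → Term
apps U []       = U
apps U (W ∷ Ws) = apps (app U W) Ws

Ren : Set
Ren = ℕ → ℕ

Sub : Set
Sub = ℕ → Term

extR : Ren → Ren
extR ρ zero    = zero
extR ρ (suc n) = suc (ρ n)

rename : Ren → Term → Term
rename ρ (var n)   = var (ρ n)
rename ρ H         = H
rename ρ (lam t)   = lam (rename (extR ρ) t)
rename ρ (app t u) = app (rename ρ t) (rename ρ u)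

extS : Sub → Sub
extS σ zero    = var zero
extS σ (suc n) = rename suc (σ n)

subst : Sub → Term → Term
subst σ (var n)   = σ n
subst σ H         = H
subst σ (lam t)   = lam (subst (extS σ) t)
subst σ (app t u) = app (subst σ t) (subst σ u)

single : Term → Sub
single B zero    = B
single B (suc n) = var n

_[_] : Term → Term → Term
A [ B ] = subst (single B) A

Rel : Set₁
Rel = Term → Term → Set

data UnderLams (R : Rel) : Rel where
  here  : ∀ {U V} → R U V → UnderLams R U V
  under : ∀ {U V} → UnderLams R U V → UnderLams R (lam U) (lam V)

data tBase : Rel where
  beta : ∀ A B Ws → tBase (apps (app (lam A) B) Ws) (apps (A [ B ]) Ws)

data IBase : Rel where
  I-step : ∀ U₁ Us → IBase (apps H (U₁ ∷ Us)) (apps U₁ Us)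

data JBase : Rel where
  J-step  : ∀ U₁ U₂ Us → JBase (apps H (U₁ ∷ U₂ ∷ Us)) (apps U₁ (app H U₂ ∷ Us))
  J-step₁ : ∀ U₁ → JBase (app H U₁) U₁

_→t_ : Rel
_→t_ = UnderLams tBase

_→I_ : Rel
_→I_ = UnderLams IBase

_→J_ : Rel
_→J_ = UnderLams JBase

data Steps (R : Rel) : ℕ → Term → Term → Set where
  done  : ∀ {U} → Steps R 0 U U
  stepR : ∀ {k U V W} → R U V → Steps R k V W → Steps R k U W
  stepT : ∀ {k U V W} → U →t V → Steps R k V W → Steps R (suc k) U W

_→⟨I*,_⟩_ : Term → ℕ → Term → Set
U →⟨I*, k ⟩ V = Steps _→I_ k U V

_→⟨J*,_⟩_ : Term → ℕ → Term → Set
U →⟨J*, k ⟩ V = Steps _→J_ k U V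

-- Since the clause
-- E(H U₁…Uₙ) = E(U₁…Uₙ) is not structurally recursive, E is computed
-- with fuel; the fuel `size U` is always sufficient (each recursive call
-- is on a strictly smaller term).

size : Term → ℕ
size (var _)   = 1
size H         = 1
size (lam t)   = suc (size t)
size (app t u) = suc (size t + size u)

headH : Term → Maybe (List Term)
headH (var _)   = nothing
headH H         = just []
headH (lam _)   = nothing
headH (app t u) = Maybe.map (_∷ʳ u) (headH t)

Ef : ℕ → Term → Term
Ef zero    t         = t
Ef (suc n) (var x)   = var x
Ef (suc n) H         = H
Ef (suc n) (lam U)   = lam (Ef n U)
Ef (suc n) (app U V) with headH U
... | nothing       = app (Ef n U) (Ef n V)
... | just []       = Ef n V
... | just (U₁ ∷ Us) = Ef n (apps U₁ (Us ∷ʳ V))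

E : Term → Term
E U = Ef (size U) U

module Submission where

-- E agrees with the structurally recursive map `erase`, which rebuilds a
-- term bottom-up and drops every H standing in function position.
-- An I- or J-step only moves or deletes such an H, so it leaves the erasure
-- unchanged.  A head β-redex erases to a head β-redex whose components are
-- the erased components, and erasure commutes with substitution up to
-- re-erasing; hence two t-steps from terms with equal erasures end in terms
-- with equal erasures, and the k t-steps of both sequences can be matched
-- one by one.

open import Defs
open import Data.Nat using (ℕ; zero; suc; _+_; _≤_; s≤s)
open import Data.Nat.Properties
  using (m≤m+n; m≤n+m; n≤1+n; ≤-refl; ≤-reflexive; ≤-trans)
open import Data.List using (List; []; _∷_; _∷ʳ_; _++_; map)
open import Data.List.Properties using (map-++; ++-assoc; ++-identityʳ; ∷-injective)
open import Data.Maybe using (just; nothing)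
open import Data.Product using (_×_; _,_)
open import Data.Empty using (⊥-elim)
open import Function using (_∘_)
open import Relation.Binary.PropositionalEquality
  using (_≡_; _≢_; refl; sym; trans; cong; cong₂; module ≡-Reasoning)

open ≡-Reasoning

infixl 7 _·_ _·*_

_·_ : Term → Term → Term
H       · Y = Y
var n   · Y = app (var n) Y
lam t   · Y = app (lam t) Y
app s t · Y = app (app s t) Y

_·*_ : Term → List Term → Term
X ·* []       = X
X ·* (Y ∷ Ys) = (X · Y) ·* Ys

erase : Term → Term
erase (var n)   = var n
erase H         = H
erase (lam t)   = lam (erase t)
erase (app t u) = erase t · erase u

·-≢H : ∀ {X} Y → X ≢ H → X · Y ≡ app X Y
·-≢H {H}       Y X≢H = ⊥-elim (X≢H refl)
·-≢H {var _}   Y _   = refl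
·-≢H {lam _}   Y _   = refl
·-≢H {app _ _} Y _   = refl

·*-app : ∀ X Y Ys → app X Y ·* Ys ≡ apps (app X Y) Ys
·*-app X Y []       = refl
·*-app X Y (Z ∷ Zs) = ·*-app (app X Y) Z Zs

·*-∷ʳ : ∀ X Ys Y → X ·* (Ys ∷ʳ Y) ≡ (X ·* Ys) · Y
·*-∷ʳ X []       Y = refl
·*-∷ʳ X (Z ∷ Zs) Y = ·*-∷ʳ (X · Z) Zs Y

apps-∷ʳ : ∀ X ws u → apps X (ws ∷ʳ u) ≡ app (apps X ws) u
apps-∷ʳ X []       u = refl
apps-∷ʳ X (w ∷ ws) u = apps-∷ʳ (app X w) ws u

erase-apps : ∀ X ws → erase (apps X ws) ≡ erase X ·* map erase ws
erase-apps X []       = refl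
erase-apps X (w ∷ ws) = erase-apps (app X w) ws

headH-just : ∀ U {ws} → headH U ≡ just ws → U ≡ apps H ws
headH-just H         refl = refl
headH-just (app t u) eq with headH t in eqt
headH-just (app t u) refl | just vs = begin
  app t u             ≡⟨ cong (λ s → app s u) (headH-just t eqt) ⟩
  app (apps H vs) u   ≡⟨ sym (apps-∷ʳ H vs u) ⟩
  apps H (vs ∷ʳ u)    ∎

erase-≢H : ∀ U → headH U ≡ nothing → erase U ≢ H
erase-≢H (var _)   _ ()
erase-≢H (lam _)   _ ()
erase-≢H (app t u) _  eq with headH t in eqt
... | nothing with trans (sym (·-≢H (erase u) (erase-≢H t eqt))) eq
...   | ()

size-apps-cong : ∀ {X Y} ws → size X ≡ size Y → size (apps X ws) ≡ size (apps Y ws)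
size-apps-cong []       eq = eq
size-apps-cong (w ∷ ws) eq = size-apps-cong ws (cong (λ s → suc (s + size w)) eq)

size-apps-H : ∀ X ws V →
  suc (size (apps X (ws ∷ʳ V))) ≡ size (apps (app H X) ws) + size V
size-apps-H X []       V = refl
size-apps-H X (w ∷ ws) V = trans (size-apps-H (app X w) ws V)
  (cong (_+ size V) (size-apps-cong ws refl))

Ef≡erase : ∀ n U → size U ≤ n → Ef n U ≡ erase U
Ef≡erase (suc n) (var _)   _        = refl
Ef≡erase (suc n) H         _        = refl
Ef≡erase (suc n) (lam U)   (s≤s le) = cong lam (Ef≡erase n U le)
Ef≡erase (suc n) (app U V) (s≤s le) with headH U in eqU
... | nothing = begin
  app (Ef n U) (Ef n V)   ≡⟨ cong₂ app (Ef≡erase n U (≤-trans (m≤m+n _ _) le))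
                                       (Ef≡erase n V (≤-trans (m≤n+m _ _) le)) ⟩
  app (erase U) (erase V) ≡⟨ sym (·-≢H (erase V) (erase-≢H U eqU)) ⟩
  erase U · erase V       ∎
... | just [] with refl ← headH-just U eqU = Ef≡erase n V (≤-trans (m≤n+m _ _) le)
... | just (U₁ ∷ Us) with refl ← headH-just U eqU = begin
  Ef n (apps U₁ (Us ∷ʳ V))                     ≡⟨ Ef≡erase n _ bound ⟩
  erase (apps U₁ (Us ∷ʳ V))                    ≡⟨ erase-apps U₁ (Us ∷ʳ V) ⟩
  erase U₁ ·* map erase (Us ∷ʳ V)              ≡⟨ cong (erase U₁ ·*_) (map-++ erase Us (V ∷ [])) ⟩
  erase U₁ ·* (map erase Us ∷ʳ erase V)        ≡⟨ ·*-∷ʳ (erase U₁) (map erase Us) (erase V) ⟩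
  (erase U₁ ·* map erase Us) · erase V         ≡⟨ cong (_· erase V) (sym (erase-apps (app H U₁) Us)) ⟩
  erase (apps (app H U₁) Us) · erase V         ∎
  where
  bound : size (apps U₁ (Us ∷ʳ V)) ≤ n
  bound = ≤-trans (n≤1+n _) (≤-trans (≤-reflexive (size-apps-H U₁ Us V)) le)

E≡erase : ∀ U → E U ≡ erase U
E≡erase U = Ef≡erase (size U) U ≤-refl

→I-erase : ∀ {U V} → U →I V → erase U ≡ erase V
→I-erase (here (I-step U₁ Us)) = trans (erase-apps H (U₁ ∷ Us)) (sym (erase-apps U₁ Us))
→I-erase (under r)             = cong lam (→I-erase r)

→J-erase : ∀ {U V} → U →J V → erase U ≡ erase V
→J-erase (here (J-step U₁ U₂ Us)) =
  trans (erase-apps H (U₁ ∷ U₂ ∷ Us)) (sym (erase-apps U₁ (app H U₂ ∷ Us)))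
→J-erase (here (J-step₁ U₁))      = refl
→J-erase (under r)                = cong lam (→J-erase r)

subst· : Sub → Term → Term
subst· σ (var n)   = σ n
subst· σ H         = H
subst· σ (lam t)   = lam (subst· (extS σ) t)
subst· σ (app t u) = subst· σ t · subst· σ u

rename-· : ∀ ρ X Y → rename ρ (X · Y) ≡ rename ρ X · rename ρ Y
rename-· ρ H         Y = refl
rename-· ρ (var _)   Y = refl
rename-· ρ (lam _)   Y = refl
rename-· ρ (app _ _) Y = refl

subst·-· : ∀ σ X Y → subst· σ (X · Y) ≡ subst· σ X · subst· σ Y
subst·-· σ H         Y = refl
subst·-· σ (var _)   Y = refl
subst·-· σ (lam _)   Y = refl
subst·-· σ (app _ _) Y = refl

erase-rename : ∀ ρ t → erase (rename ρ t) ≡ rename ρ (erase t)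
erase-rename ρ (var _)   = refl
erase-rename ρ H         = refl
erase-rename ρ (lam t)   = cong lam (erase-rename (extR ρ) t)
erase-rename ρ (app t u) = trans (cong₂ _·_ (erase-rename ρ t) (erase-rename ρ u))
                                 (sym (rename-· ρ (erase t) (erase u)))

subst·-cong : ∀ {σ τ} → (∀ n → σ n ≡ τ n) → ∀ t → subst· σ t ≡ subst· τ t
subst·-cong σ≗τ (var n)   = σ≗τ n
subst·-cong σ≗τ H         = refl
subst·-cong σ≗τ (lam t)   = cong lam (subst·-cong extS≗ t)
  where
  extS≗ : ∀ n → extS _ n ≡ extS _ n
  extS≗ zero    = refl
  extS≗ (suc n) = cong (rename suc) (σ≗τ n)
subst·-cong σ≗τ (app t u) = cong₂ _·_ (subst·-cong σ≗τ t) (subst·-cong σ≗τ u)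

erase-subst : ∀ σ t → erase (subst σ t) ≡ subst· (erase ∘ σ) t
erase-subst σ (var _)   = refl
erase-subst σ H         = refl
erase-subst σ (lam t)   = cong lam (trans (erase-subst (extS σ) t) (subst·-cong erase-extS t))
  where
  erase-extS : ∀ n → erase (extS σ n) ≡ extS (erase ∘ σ) n
  erase-extS zero    = refl
  erase-extS (suc n) = erase-rename suc (σ n)
erase-subst σ (app t u) = cong₂ _·_ (erase-subst σ t) (erase-subst σ u)

subst·-erase : ∀ σ t → subst· σ (erase t) ≡ subst· σ t
subst·-erase σ (var _)   = refl
subst·-erase σ H         = refl
subst·-erase σ (lam t)   = cong lam (subst·-erase (extS σ) t)
subst·-erase σ (app t u) = trans (subst·-· σ (erase t) (erase u))
                                 (cong₂ _·_ (subst·-erase σ t) (subst·-erase σ u))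

erase-[] : ∀ A B → erase (A [ B ]) ≡ subst· (single (erase B)) (erase A)
erase-[] A B = begin
  erase (A [ B ])                        ≡⟨ erase-subst (single B) A ⟩
  subst· (erase ∘ single B) A            ≡⟨ subst·-cong erase-single A ⟩
  subst· (single (erase B)) A            ≡⟨ sym (subst·-erase (single (erase B)) A) ⟩
  subst· (single (erase B)) (erase A)    ∎
  where
  erase-single : ∀ n → erase (single B n) ≡ single (erase B) n
  erase-single zero    = refl
  erase-single (suc _) = refl

erase-redex : ∀ A B Ws →
  erase (apps (app (lam A) B) Ws) ≡ apps (app (lam (erase A)) (erase B)) (map erase Ws)
erase-redex A B Ws = trans (erase-apps (app (lam A) B) Ws)
                           (·*-app (lam (erase A)) (erase B) (map erase Ws))

apps-app≢lam : ∀ X Y ws {Z} → apps (app X Y) ws ≢ lam Z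
apps-app≢lam X Y []       ()
apps-app≢lam X Y (w ∷ ws) = apps-app≢lam (app X Y) w ws

spineHead : Term → Term
spineHead (app t _) = spineHead t
spineHead t         = t

spineArgs : Term → List Term
spineArgs (app t u) = spineArgs t ∷ʳ u
spineArgs _         = []

spineHead-apps : ∀ X ws → spineHead (apps X ws) ≡ spineHead X
spineHead-apps X []       = refl
spineHead-apps X (w ∷ ws) = spineHead-apps (app X w) ws

spineArgs-apps : ∀ X ws → spineArgs (apps X ws) ≡ spineArgs X ++ ws
spineArgs-apps X []       = sym (++-identityʳ _)
spineArgs-apps X (w ∷ ws) = trans (spineArgs-apps (app X w) ws) (++-assoc (spineArgs X) (w ∷ []) ws)

redex-injective : ∀ A B Ws A′ B′ Ws′ →
  apps (app (lam A) B) Ws ≡ apps (app (lam A′) B′) Ws′ → A ≡ A′ × B ≡ B′ × Ws ≡ Ws′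
redex-injective A B Ws A′ B′ Ws′ eq with
  trans (sym (spineHead-apps _ Ws)) (trans (cong spineHead eq) (spineHead-apps _ Ws′))
  | ∷-injective (trans (sym (spineArgs-apps _ Ws)) (trans (cong spineArgs eq) (spineArgs-apps _ Ws′)))
... | refl | refl , refl = refl , refl , refl

→t-erase : ∀ {U₁ U₂ V₁ V₂} → U₁ →t V₁ → U₂ →t V₂ → erase U₁ ≡ erase U₂ → erase V₁ ≡ erase V₂
→t-erase (under r₁) (under r₂) eq = cong lam (→t-erase r₁ r₂ (cong stripLam eq))
  where
  stripLam : Term → Term
  stripLam (lam t) = t
  stripLam t       = t
→t-erase (here (beta A B Ws)) (under _) eq =
  ⊥-elim (apps-app≢lam _ _ (map erase Ws) (trans (sym (erase-redex A B Ws)) eq))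
→t-erase (under _) (here (beta A B Ws)) eq =
  ⊥-elim (apps-app≢lam _ _ (map erase Ws) (trans (sym (erase-redex A B Ws)) (sym eq)))
→t-erase (here (beta A B Ws)) (here (beta A′ B′ Ws′)) eq
  with redex-injective (erase A) (erase B) (map erase Ws) (erase A′) (erase B′) (map erase Ws′)
         (trans (sym (erase-redex A B Ws)) (trans eq (erase-redex A′ B′ Ws′)))
... | eA , eB , eWs = begin
  erase (apps (A [ B ]) Ws)                                    ≡⟨ erase-apps (A [ B ]) Ws ⟩
  erase (A [ B ]) ·* map erase Ws                              ≡⟨ cong (_·* map erase Ws) (erase-[] A B) ⟩
  subst· (single (erase B)) (erase A) ·* map erase Ws          ≡⟨ cong₂ (λ b a → subst· (single b) a ·* map erase Ws) eB eA ⟩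
  subst· (single (erase B′)) (erase A′) ·* map erase Ws        ≡⟨ cong (_ ·*_) eWs ⟩
  subst· (single (erase B′)) (erase A′) ·* map erase Ws′       ≡⟨ cong (_·* map erase Ws′) (sym (erase-[] A′ B′)) ⟩
  erase (A′ [ B′ ]) ·* map erase Ws′                           ≡⟨ sym (erase-apps (A′ [ B′ ]) Ws′) ⟩
  erase (apps (A′ [ B′ ]) Ws′)                                 ∎

Steps-erase : ∀ {k U₁ U₂ V₁ V₂} → Steps _→I_ k U₁ V₁ → Steps _→J_ k U₂ V₂ →
  erase U₁ ≡ erase U₂ → erase V₁ ≡ erase V₂
Steps-erase (stepR r s₁)   s₂             eq = Steps-erase s₁ s₂ (trans (sym (→I-erase r)) eq)
Steps-erase done           done           eq = eq
Steps-erase s₁@done        (stepR r s₂)   eq = Steps-erase s₁ s₂ (trans eq (→J-erase r))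
Steps-erase s₁@(stepT _ _) (stepR r s₂)   eq = Steps-erase s₁ s₂ (trans eq (→J-erase r))
Steps-erase (stepT t₁ s₁)  (stepT t₂ s₂)  eq = Steps-erase s₁ s₂ (→t-erase t₁ t₂ eq)

lemma3p14 : (U₁ U₂ V₁ V₂ : Term) (k : ℕ) →
            U₁ →⟨I*, k ⟩ V₁ → U₂ →⟨J*, k ⟩ V₂ → E U₁ ≡ E U₂ → E V₁ ≡ E V₂
lemma3p14 U₁ U₂ V₁ V₂ k s₁ s₂ eq = begin
  E V₁       ≡⟨ E≡erase V₁ ⟩
  erase V₁   ≡⟨ Steps-erase s₁ s₂ (trans (sym (E≡erase U₁)) (trans eq (E≡erase U₂))) ⟩
  erase V₂   ≡⟨ sym (E≡erase V₂) ⟩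
  E V₂       ∎
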